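{- For every hypergraph $\mathcal{H}$ and all integers $\lambda\ge1$ and $r\ge1$, $cms_r(\lambda\mathcal{H})\ge cms_r(\mathcal{H})$.
   Context: A hypergraph $\mathcal{H}=(V,E)$ consists of a finite vertex set $V$ and a finite set $E$ of edges, each with an associated vertex set; parallel edges are allowed. $\lambda\mathcal{H}$ is obtained by replacing each edge by $\lambda$ distinct parallel edges. $[n]=\{0,\ldots,n-1\}$. An ordering of $\mathcal{H}$ is a bijection $\ell:E\to[\varepsilon]$, $\varepsilon=|E|$. For a sequence $S=e_0,\ldots,e_{s-1}$ of (not necessarily distinct) edges, $\mathcal{H}(S)$ is the hypergraph whose edges are the $s$ terms of $S$ counted with multiplicity. $S$ is cyclically consecutive in $\ell$ if $\ell(e_i)\equiv\ell(e_0)+i\pmod{\varepsilon}$ for all $i$ ($s$ may exceed $\varepsilon$). $cms_r(\ell)$ is the largest $s$ such that every sequence $S$ of $s$ cyclically consecutive edges of $\ell$ satisfies $\Delta(\mathcal{H}(S))\le r$, where $\Delta$ is maximum degree; $cms_r(\mathcal{H})$ is its maximum over all orderings $\ell$. -}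

module Defs where

open import Data.Nat using (ℕ; zero; suc; _+_; _*_; _≤_)
open import Data.Nat.DivMod using (_mod_)
open import Data.Fin using (Fin; toℕ; quotient)
open import Data.Fin.Subset using (Subset; _∈_)
open import Data.Fin.Subset.Properties using (_∈?_)
open import Data.Fin.Permutation using (Permutation′; _⟨$⟩ˡ_)
open import Data.List using (List; length; filter; upTo)

-- Distinct indices may carry equal vertex sets (parallel edges allowed).
record Hypergraph : Set where
  field
    nV    : ℕ
    nE    : ℕ
    edge  : Fin nE → Subset nV
open Hypergraph public

-- λH : each edge e replaced by λ distinct parallel copies.
-- Edge set Fin (ε * λ); edge k is a copy of edge (quotient λ k) of H.
blowUp : ℕ → Hypergraph → Hypergraph
blowUp λ' H = record
  { nV = nV H
  ; nE = nE H * λ'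
  ; edge = λ k → edge H (quotient λ' k)
  }

-- An ordering ℓ : E → [ε] is a bijection; represented as a permutation
-- of Fin ε, with ℓ ⟨$⟩ʳ e = ℓ(e) the position of edge e and
-- ℓ ⟨$⟩ˡ p the edge at position p.
Ordering : Hypergraph → Set
Ordering H = Permutation′ (nE H)

-- Degree of vertex v in H(S), where S is the sequence of s cyclically
-- consecutive edges of ℓ starting at position p:
-- S_i = ℓ⁻¹((p + i) mod ε), i = 0 .. s-1, counted with multiplicity.
windowDeg : (n ε : ℕ) → (Fin ε → Subset n) → Permutation′ ε → Fin ε → ℕ
          → Fin n → ℕ
windowDeg n (suc k) e ℓ p s v =
  length (filter (λ i → v ∈? e (ℓ ⟨$⟩ˡ ((toℕ p + i) mod suc k))) (upTo s))

windowDegree : (H : Hypergraph) → Ordering H → (p : Fin (nE H)) → (s : ℕ)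
             → Fin (nV H) → ℕ
windowDegree H = windowDeg (nV H) (nE H) (edge H)

-- Every sequence of s cyclically consecutive edges of ℓ has Δ(H(S)) ≤ r.
-- (Sequences of cyclically consecutive edges are determined by their
-- starting position p = ℓ(e_0) and their length s.)
WindowsOK : (H : Hypergraph) → Ordering H → (r s : ℕ) → Set
WindowsOK H ℓ r s = (p : Fin (nE H)) (v : Fin (nV H)) → windowDegree H ℓ p s v ≤ r

-- "cms_r(H) ≥ s": some ordering ℓ has cms_r(ℓ) ≥ s, i.e. the largest s'
-- with WindowsOK H ℓ r s' is at least s, i.e. WindowsOK holds at some s' ≥ s.
-- (This also covers the case where cms is unbounded.)
CmsAtLeast : Hypergraph → (r s : ℕ) → Set
CmsAtLeast H r s = Σ (Ordering H) λ ℓ → Σ ℕ λ s' → (s ≤ s') × WindowsOK H ℓ r s'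
  where open import Data.Product using (Σ; _×_)

-- Order the λ copies of the edges by repeating ℓ λ times: position j·ε + x of the new
-- ordering holds the j-th copy of the edge at position x of ℓ. Position q of the blow-up
-- then carries the vertex set of position q mod ε of ℓ, and since ε divides λε, a
-- window of s consecutive positions starting at p has the same sequence of vertex sets
-- as the window of ℓ starting at p mod ε, so their degrees coincide.
module Submission where

open import Defs
open import Data.Nat using (ℕ; NonZero; zero; suc; _+_; _*_; _%_; _≤_)
open import Data.Nat.Properties using (*-comm; ≤-trans; ≤-reflexive)
open import Data.Nat.DivMod
  using (_mod_; %-distribˡ-+; m%n%n≡m%n; %-remove-+ˡ; m<n⇒m%n≡m; m%n<n; m∣n⇒o%n%m≡o%m)
open import Data.Nat.Divisibility using (m∣m*n)
open import Data.Fin using (Fin; toℕ; quotient; remainder; remQuot; combine; cast)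
open import Data.Fin.Properties
  using (*↔×; toℕ-injective; toℕ-fromℕ<; fromℕ<-cong; toℕ-cast; remQuot-combine;
         combine-remQuot; toℕ-combine; toℕ<n)
open import Data.Fin.Subset using (Subset; _∈_)
open import Data.Fin.Subset.Properties using (_∈?_)
open import Data.Fin.Permutation using (Permutation′; _⟨$⟩ˡ_; cast-id)
open import Data.List using (List; length; filter; upTo)
open import Data.List.Properties using (filter-≐)
open import Data.Product using (_,_; proj₁; proj₂)
open import Data.Product.Algebra using (×-comm)
open import Data.Product.Function.NonDependent.Propositional using (_×-↔_)
open import Function using (_∘_)
open import Function.Construct.Composition using (_↔-∘_)
open import Function.Construct.Identity using (↔-id)
open import Function.Construct.Symmetry using (↔-sym)
open import Relation.Binary.PropositionalEquality

toℕ-mod : ∀ m n .{{_ : NonZero n}} → toℕ (m mod n) ≡ m % n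
toℕ-mod m n = toℕ-fromℕ< (m%n<n m n)

mod-cong : ∀ {m m′} n .{{_ : NonZero n}} → m % n ≡ m′ % n → m mod n ≡ m′ mod n
mod-cong n eq = fromℕ<-cong _ _ eq _ _

[m%n+k]%n≡[m+k]%n : ∀ m k n .{{_ : NonZero n}} → (m % n + k) % n ≡ (m + k) % n
[m%n+k]%n≡[m+k]%n m k n = begin
  (m % n + k) % n         ≡⟨ %-distribˡ-+ (m % n) k n ⟩
  (m % n % n + k % n) % n ≡⟨ cong (λ x → (x + k % n) % n) (m%n%n≡m%n m n) ⟩
  (m % n + k % n) % n     ≡⟨ %-distribˡ-+ m k n ⟨
  (m + k) % n             ∎
  where open ≡-Reasoning

toℕ-remainder : ∀ {m} n .{{_ : NonZero n}} (i : Fin (m * n)) →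
                toℕ (remainder {m} n i) ≡ toℕ i % n
toℕ-remainder {m} n i = begin
  toℕ r                     ≡⟨ m<n⇒m%n≡m (toℕ<n r) ⟨
  toℕ r % n                 ≡⟨ %-remove-+ˡ (toℕ r) (m∣m*n (toℕ q)) ⟨
  (n * toℕ q + toℕ r) % n   ≡⟨ cong (_% n) (toℕ-combine q r) ⟨
  toℕ (combine q r) % n     ≡⟨ cong (λ j → toℕ j % n) (combine-remQuot {m} n i) ⟩
  toℕ i % n                 ∎
  where
  open ≡-Reasoning
  q = proj₁ (remQuot {m} n i)
  r = proj₂ (remQuot {m} n i)

repeat : ∀ {ε} λ′ → Permutation′ ε → Permutation′ (ε * λ′)
repeat {ε} λ′ ℓ =
  cast-id (*-comm λ′ ε) ↔-∘ (↔-sym *↔× ↔-∘ (×-comm _ _ ↔-∘ ((ℓ ×-↔ ↔-id _) ↔-∘ *↔×)))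

quotient-repeat : ∀ {ε} λ′ .{{_ : NonZero ε}} (ℓ : Permutation′ ε) (q : Fin (ε * λ′)) →
                  quotient λ′ (repeat λ′ ℓ ⟨$⟩ˡ q) ≡ ℓ ⟨$⟩ˡ (toℕ q mod ε)
quotient-repeat {ε} λ′ ℓ q = begin
  quotient λ′ (combine (ℓ ⟨$⟩ˡ remainder {λ′} ε q′) (quotient ε q′))
    ≡⟨ cong proj₁ (remQuot-combine (ℓ ⟨$⟩ˡ remainder {λ′} ε q′) (quotient ε q′)) ⟩
  ℓ ⟨$⟩ˡ remainder {λ′} ε q′
    ≡⟨ cong (ℓ ⟨$⟩ˡ_) (toℕ-injective toℕ-remainder-q′) ⟩
  ℓ ⟨$⟩ˡ (toℕ q mod ε) ∎
  where
  open ≡-Reasoning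
  q′ = cast (sym (*-comm λ′ ε)) q
  toℕ-remainder-q′ : toℕ (remainder {λ′} ε q′) ≡ toℕ (toℕ q mod ε)
  toℕ-remainder-q′ = begin
    toℕ (remainder {λ′} ε q′) ≡⟨ toℕ-remainder {λ′} ε q′ ⟩
    toℕ q′ % ε                ≡⟨ cong (_% ε) (toℕ-cast _ q) ⟩
    toℕ q % ε                 ≡⟨ toℕ-mod (toℕ q) ε ⟨
    toℕ (toℕ q mod ε)         ∎

window-mod : ∀ ε λ′ .{{_ : NonZero ε}} .{{_ : NonZero (ε * λ′)}} (p i : ℕ) →
             toℕ ((p + i) mod (ε * λ′)) mod ε ≡ (toℕ (p mod ε) + i) mod ε
window-mod ε λ′ p i = mod-cong ε (begin
  toℕ ((p + i) mod (ε * λ′)) % ε ≡⟨ cong (_% ε) (toℕ-mod (p + i) (ε * λ′)) ⟩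
  (p + i) % (ε * λ′) % ε         ≡⟨ m∣n⇒o%n%m≡o%m ε (ε * λ′) (p + i) (m∣m*n λ′) ⟩
  (p + i) % ε                    ≡⟨ [m%n+k]%n≡[m+k]%n p i ε ⟨
  (p % ε + i) % ε                ≡⟨ cong (λ x → (x + i) % ε) (toℕ-mod p ε) ⟨
  (toℕ (p mod ε) + i) % ε        ∎)
  where open ≡-Reasoning

count-∈-cong : ∀ {n} (v : Fin n) {f g : ℕ → Subset n} → (∀ i → f i ≡ g i) → (xs : List ℕ) →
               length (filter (λ i → v ∈? f i) xs) ≡ length (filter (λ i → v ∈? g i) xs)
count-∈-cong v f≡g xs =
  cong length (filter-≐ (λ i → v ∈? _) (λ i → v ∈? _)
                        ((λ {i} → subst (v ∈_) (f≡g i)) , (λ {i} → subst (v ∈_) (sym (f≡g i))))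
                        xs)

windowDeg-repeat : ∀ n k l (e : Fin (suc k) → Subset n) (ℓ : Permutation′ (suc k))
                   (p : Fin (suc k * suc l)) (s : ℕ) (v : Fin n) →
                   windowDeg n (suc k * suc l) (e ∘ quotient (suc l)) (repeat (suc l) ℓ) p s v
                     ≡ windowDeg n (suc k) e ℓ (toℕ p mod suc k) s v
windowDeg-repeat n k l e ℓ p s v = count-∈-cong v same-vertex-sets (upTo s)
  where
  same-vertex-sets : ∀ i → e (quotient (suc l) (repeat (suc l) ℓ ⟨$⟩ˡ ((toℕ p + i) mod (suc k * suc l))))
                         ≡ e (ℓ ⟨$⟩ˡ ((toℕ (toℕ p mod suc k) + i) mod suc k))
  same-vertex-sets i = cong e (trans (quotient-repeat (suc l) ℓ ((toℕ p + i) mod (suc k * suc l)))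
                                     (cong (ℓ ⟨$⟩ˡ_) (window-mod (suc k) (suc l) (toℕ p) i)))

windowsOK-blowUp : ∀ (H : Hypergraph) l (ℓ : Ordering H) {r s} →
                   WindowsOK H ℓ r s → WindowsOK (blowUp (suc l) H) (repeat (suc l) ℓ) r s
windowsOK-blowUp record { nE = zero } l ℓ ok ()
windowsOK-blowUp record { nV = n ; nE = suc k ; edge = e } l ℓ {s = s} ok p v =
  ≤-trans (≤-reflexive (windowDeg-repeat n k l e ℓ p s v)) (ok (toℕ p mod suc k) v)

lemma2p7 : (H : Hypergraph) (λ' r : ℕ) → 1 ≤ λ' → 1 ≤ r →
    (s : ℕ) → CmsAtLeast H r s → CmsAtLeast (blowUp λ' H) r s
lemma2p7 H (suc l) r _ _ s (ℓ , s′ , s≤s′ , ok) =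
  repeat (suc l) ℓ , s′ , s≤s′ , windowsOK-blowUp H l ℓ ok
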